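{- Let $m,n\geq 2$, $X=\{1,2,\ldots,m\}$, $Y=\{\bar1,\ldots,\bar n\}$ (disjoint), and $k$ an integer with $0<k<m+n-2$. Let $\mathcal F_{X,Y}^k$ be the set of forests with vertex set $X\sqcup Y$ with exactly $k$ connected components all of whose edges join $X$ to $Y$, $\Phi_{X,Y,k}=\sum_{F\in\mathcal F_{X,Y}^k}\prod_{e\in E(F)}x_e$, and $\widetilde H_{\Phi_{X,Y,k}}$ its Hessian matrix (indexed by edges of $K_{X,Y}$) evaluated at $x_e=1$ for all $e$. Let $p,q,r$ be the numbers of $F\in\mathcal F_{X,Y}^k$ containing the edges $\{1,\bar1\},\{1,\bar2\}$, resp. $\{1,\bar1\},\{\bar1,2\}$, resp. $\{1,\bar1\},\{2,\bar2\}$. Then the eigenvalues of $\widetilde H_{\Phi_{X,Y,k}}$ are $$(n-1)p+(m-1)q+(m-1)(n-1)r,\quad (n-1)p-q-(n-1)r,\quad -p+(m-1)q-(m-1)r,\quad -p-q+r,$$ with associated eigenspaces of dimensions $1$, $m-1$, $n-1$ and $(m-1)(n-1)$, respectively.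
   Context: The edges of the complete bipartite graph $K_{X,Y}$ are the sets $\{x,y\}$, $x\in X$, $y\in Y$. A forest is an acyclic graph; here a spanning acyclic subgraph of $K_{X,Y}$. The Hessian matrix is $\left(\frac{\partial^2\Phi_{X,Y,k}}{\partial x_e\partial x_{e'}}\right)_{e,e'}$. -}

module Defs where

open import Data.Nat as ℕ using (ℕ; zero; suc; _≤_; _<_; s≤s; z≤n)
open import Data.Nat.Properties using (≤-trans)
open import Data.Integer using (+_)
open import Data.Rational as ℚ using (ℚ; 0ℚ; _/_)
open import Data.Bool using (Bool; true)
open import Data.Fin using (Fin; zero; suc; inject₁; fromℕ; fromℕ<)
open import Data.Vec using (Vec; lookup)
open import Data.Sum using (_⊎_; inj₁; inj₂)
open import Data.Product using (Σ; _×_; _,_; ∃)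
open import Data.Empty using (⊥)
open import Data.List using (List; length)
open import Data.List.Membership.Propositional using (_∈_)
open import Data.List.Relation.Unary.Unique.Propositional using (Unique)
open import Relation.Binary.PropositionalEquality using (_≡_; _≢_)
open import Relation.Binary.Construct.Closure.ReflexiveTransitive using (Star)
open import Function.Definitions using (Injective; Surjective)
open import Data.Vec.Functional using (Vector; _++_)

-- The bipartite setting: X = Fin m, Y = Fin n (disjoint), vertices X ⊔ Y,
-- edges of K_{X,Y} are pairs (i , j) = {i , j̄}.

Vertex : ℕ → ℕ → Set
Vertex m n = Fin m ⊎ Fin n

Edge : ℕ → ℕ → Set
Edge m n = Fin m × Fin n

-- A spanning subgraph of K_{X,Y} = a set of edges, as an m×n Boolean table.
EdgeSet : ℕ → ℕ → Set
EdgeSet m n = Vec (Vec Bool n) m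

_∈E_ : ∀ {m n} → Edge m n → EdgeSet m n → Set
(i , j) ∈E F = lookup (lookup F i) j ≡ true

Adj : ∀ {m n} → EdgeSet m n → Vertex m n → Vertex m n → Set
Adj F (inj₁ i) (inj₁ i') = ⊥
Adj F (inj₁ i) (inj₂ j)  = (i , j) ∈E F
Adj F (inj₂ j) (inj₁ i)  = (i , j) ∈E F
Adj F (inj₂ j) (inj₂ j') = ⊥

-- A cycle of length l+3: distinct vertices v₀,…,v_{l+2}, consecutive ones
-- adjacent, and the last adjacent to the first.
record Cycle {m n} (F : EdgeSet m n) : Set where
  field
    len   : ℕ
    vtx   : Fin (suc (suc (suc len))) → Vertex m n
    inj   : Injective _≡_ _≡_ vtx
    step  : ∀ (i : Fin (suc (suc len))) → Adj F (vtx (inject₁ i)) (vtx (suc i))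
    close : Adj F (vtx (fromℕ (suc (suc len)))) (vtx zero)

Acyclic : ∀ {m n} → EdgeSet m n → Set
Acyclic F = Cycle F → ⊥

Connected : ∀ {m n} → EdgeSet m n → Vertex m n → Vertex m n → Set
Connected F = Star (Adj F)

-- F has exactly k connected components: there is a surjective labelling
-- of the vertices by Fin k whose fibres are exactly the components.
HasComponents : ∀ {m n} → EdgeSet m n → ℕ → Set
HasComponents {m} {n} F k =
  Σ (Vertex m n → Fin k) λ c →
    Surjective _≡_ _≡_ c ×
    (∀ u v → (c u ≡ c v → Connected F u v) × (Connected F u v → c u ≡ c v))

IsForestK : ∀ {m n} → ℕ → EdgeSet m n → Set
IsForestK k F = Acyclic F × HasComponents F k

IsCount : ∀ {m n} → (EdgeSet m n → Set) → ℕ → Set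
IsCount {m} {n} P c =
  Σ (List (EdgeSet m n)) λ l →
    Unique l × (∀ F → (F ∈ l → P F) × (P F → F ∈ l)) × length l ≡ c

-- Hessian of Φ_{X,Y,k} = Σ_{F} Π_{e ∈ F} x_e evaluated at x ≡ 1.
-- Φ is multilinear (each monomial is squarefree), so
--   ∂²/∂x_e∂x_e' (Π_{f∈F} x_f) |_{x=1} = 1 if e ≢ e' and e, e' ∈ F, else 0.
-- Hence H(e,e) = 0 and, for e ≢ e', H(e,e') = #{F ∈ 𝓕^k : e, e' ∈ F}.

IsHessianAtOnes : ∀ {m n} → ℕ → (Edge m n → Edge m n → ℕ) → Set
IsHessianAtOnes {m} {n} k H =
  ∀ (e e' : Edge m n) →
    (e ≡ e' → H e e' ≡ 0) ×
    (e ≢ e' → IsCount (λ F → IsForestK k F × e ∈E F × e' ∈E F) (H e e'))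

ℕtoℚ : ℕ → ℚ
ℕtoℚ p = (+ p) / 1

ΣFin : ∀ k → (Fin k → ℚ) → ℚ
ΣFin zero    f = 0ℚ
ΣFin (suc k) f = f zero ℚ.+ ΣFin k (λ i → f (suc i))

QVec : ℕ → ℕ → Set
QVec m n = Edge m n → ℚ

ΣEdge : ∀ {m n} → (Edge m n → ℚ) → ℚ
ΣEdge {m} {n} f = ΣFin m (λ i → ΣFin n (λ j → f (i , j)))

_·_ : ∀ {m n} → (Edge m n → Edge m n → ℕ) → QVec m n → QVec m n
(H · v) e = ΣEdge (λ e' → ℕtoℚ (H e e') ℚ.* v e')

IsEigenvector : ∀ {m n} → (Edge m n → Edge m n → ℕ) → ℚ → QVec m n → Set
IsEigenvector H λ' v = ∀ e → (H · v) e ≡ λ' ℚ.* v e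

lincomb : ∀ {m n d} → (Fin d → ℚ) → (Fin d → QVec m n) → QVec m n
lincomb {d = d} c b e = ΣFin d (λ i → c i ℚ.* b i e)

LinIndep : ∀ {m n d} → (Fin d → QVec m n) → Set
LinIndep {d = d} b = ∀ (c : Fin d → ℚ) → (∀ e → lincomb c b e ≡ 0ℚ) → ∀ i → c i ≡ 0ℚ

Spans : ∀ {m n d} → (Fin d → QVec m n) → Set
Spans {m} {n} {d} b = ∀ (v : QVec m n) → ∃ λ (c : Fin d → ℚ) → ∀ e → lincomb c b e ≡ v e

IsBasis : ∀ {m n d} → (Fin d → QVec m n) → Set
IsBasis b = LinIndep b × Spans b

-- The specific vertices 1, 2 ∈ X (indices 0, 1) and 1̄, 2̄ ∈ Y, for m, n ≥ 2.

fin0 : ∀ {m} → 2 ≤ m → Fin m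
fin0 h = fromℕ< (≤-trans (s≤s z≤n) h)

fin1 : ∀ {m} → 2 ≤ m → Fin m
fin1 h = fromℕ< h

{-# OPTIONS --safe #-}
module Submission where

-- The automorphisms S_m × S_n of K_{X,Y} permute the forests of 𝓕^k, so an entry H(e,e′) of the
-- Hessian only depends on how the edges e and e′ meet: it is 0, p, q or r according as e = e′,
-- e and e′ share their vertex in X, share their vertex in Y, or are disjoint.  Writing κ = J − I
-- for the adjacency matrix of a complete graph, this says H = p (I ⊗ κ) + q (κ ⊗ I) + r (κ ⊗ κ).
-- On ℚ^X, the all-ones vector and the vectors e₀ − eₐ form an eigenbasis of κ with eigenvalues
-- m − 1 and −1 (likewise on ℚ^Y), so their tensor products form an eigenbasis of H, with the four
-- stated eigenvalues; an explicit dual basis shows that these m·n vectors form a basis.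

open import Defs
open import Algebra.Bundles using (CommutativeRing)
open import Data.Empty using (⊥-elim)
open import Data.Fin using (Fin; zero; suc; _≟_; _↑ˡ_; _↑ʳ_; splitAt; combine; remQuot; punchOut)
open import Data.Fin.Permutation as Perm using (Permutation′; _⟨$⟩ʳ_; _⟨$⟩ˡ_; inverseˡ; insert)
open import Data.Fin.Properties
  using (injective⇒≤; punchIn-punchOut; splitAt⁻¹-↑ˡ; splitAt⁻¹-↑ʳ; combine-remQuot; remQuot-combine)
open import Data.List as List using (List; _∷_; length)
open import Data.List.Membership.Propositional using (_∈_)
open import Data.List.Membership.Propositional.Properties using (∈-lookup)
open import Data.List.Relation.Unary.All as All using ()
open import Data.List.Relation.Unary.AllPairs using (_∷_)
open import Data.List.Relation.Unary.Any using (index)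
open import Data.List.Relation.Unary.Any.Properties using (lookup-index)
open import Data.List.Relation.Unary.Unique.Propositional using (Unique)
import Data.Nat as ℕ
open ℕ using (ℕ; zero; suc; s≤s; z≤n)
open import Data.Nat.Properties using (≤-antisym)
open import Data.Product using (Σ; _×_; _,_; proj₁; proj₂)
import Data.Rational as ℚ
open ℚ using (ℚ; 0ℚ; 1ℚ)
open import Data.Sum as Sum using (inj₁; inj₂)
open import Data.Vec as Vec using (Vec; tabulate)
open import Data.Vec.Properties using (lookup∘tabulate; tabulate∘lookup; tabulate-cong)
open import Data.Vec.Functional using (Vector; _++_)
open import Data.Vec.Functional.Properties using (lookup-++ˡ; lookup-++ʳ)
open import Function using (_∘_; Injective; Surjective)
open import Relation.Binary.Construct.Closure.ReflexiveTransitive using (gmap)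
open import Relation.Binary.PropositionalEquality
open import Relation.Nullary using (yes; no)

-- Counting forests up to relabelling

Unique⇒lookup-injective : ∀ {A : Set} {xs : List A} → Unique xs → Injective _≡_ _≡_ (List.lookup xs)
Unique⇒lookup-injective {xs = _ ∷ _} (_ ∷ _)  {zero}  {zero}  _  = refl
Unique⇒lookup-injective {xs = _ ∷ _} (x∉ ∷ _) {zero}  {suc j} eq =
  ⊥-elim (All.lookup x∉ (∈-lookup j) eq)
Unique⇒lookup-injective {xs = _ ∷ _} (x∉ ∷ _) {suc i} {zero}  eq =
  ⊥-elim (All.lookup x∉ (∈-lookup i) (sym eq))
Unique⇒lookup-injective {xs = _ ∷ _} (_ ∷ u)  {suc i} {suc j} eq = cong suc (Unique⇒lookup-injective u eq)

IsCount-≤ : ∀ {m n} {P P′ : EdgeSet m n → Set} {c c′} (T : EdgeSet m n → EdgeSet m n) →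
  Injective _≡_ _≡_ T → (∀ F → P F → P′ (T F)) → IsCount P c → IsCount P′ c′ → c ℕ.≤ c′
IsCount-≤ T T-injective P⇒P′ (l , l-unique , l-exact , refl) (l′ , _ , l′-exact , refl) =
  injective⇒≤ position-injective
  where
  image∈l′ : ∀ i → T (List.lookup l i) ∈ l′
  image∈l′ i = proj₂ (l′-exact _) (P⇒P′ _ (proj₁ (l-exact _) (∈-lookup i)))
  position : Fin (length l) → Fin (length l′)
  position i = index (image∈l′ i)
  position-injective : Injective _≡_ _≡_ position
  position-injective {i} {j} eq = Unique⇒lookup-injective l-unique (T-injective (begin
    T (List.lookup l i)         ≡⟨ lookup-index (image∈l′ i) ⟩
    List.lookup l′ (position i) ≡⟨ cong (List.lookup l′) eq ⟩
    List.lookup l′ (position j) ≡⟨ lookup-index (image∈l′ j) ⟨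
    T (List.lookup l j)         ∎))
    where open ≡-Reasoning

module _ {m n} {F G : EdgeSet m n} (f g : Vertex m n → Vertex m n)
         (g∘f : ∀ v → g (f v) ≡ v) (f∘g : ∀ v → f (g v) ≡ v)
         (f-adj : ∀ {u v} → Adj F u v → Adj G (f u) (f v))
         (g-adj : ∀ {u v} → Adj G u v → Adj F (g u) (g v)) where

  Acyclic-transport : Acyclic F → Acyclic G
  Acyclic-transport acyclic C = acyclic record
    { len   = len
    ; vtx   = g ∘ vtx
    ; inj   = λ eq → inj (trans (sym (f∘g _)) (trans (cong f eq) (f∘g _)))
    ; step  = λ i → g-adj (step i)
    ; close = g-adj close
    }
    where open Cycle C

  HasComponents-transport : ∀ {k} → HasComponents F k → HasComponents G k
  HasComponents-transport (c , c-surjective , c-components) = c ∘ g , surjective , components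
    where
    surjective : Surjective _≡_ _≡_ (c ∘ g)
    surjective y with c-surjective y
    ... | x , cx≡y = f x , λ { refl → cx≡y (g∘f x) }
    components : ∀ u v → (c (g u) ≡ c (g v) → Connected G u v) × (Connected G u v → c (g u) ≡ c (g v))
    components u v =
      (λ same → subst₂ (Connected G) (f∘g u) (f∘g v)
                  (gmap f f-adj (proj₁ (c-components (g u) (g v)) same))) ,
      (λ path → proj₂ (c-components (g u) (g v)) (gmap g g-adj path))

  IsForestK-transport : ∀ {k} → IsForestK k F → IsForestK k G
  IsForestK-transport (acyclic , components) = Acyclic-transport acyclic , HasComponents-transport components

EdgeSet-ext : ∀ {m n} {F G : EdgeSet m n} →
  (∀ i j → Vec.lookup (Vec.lookup F i) j ≡ Vec.lookup (Vec.lookup G i) j) → F ≡ G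
EdgeSet-ext same = Vec-ext (λ i → Vec-ext (same i))
  where
  Vec-ext : ∀ {A : Set} {k} {xs ys : Vec A k} → (∀ i → Vec.lookup xs i ≡ Vec.lookup ys i) → xs ≡ ys
  Vec-ext {xs = xs} {ys} h = trans (sym (tabulate∘lookup xs)) (trans (tabulate-cong h) (tabulate∘lookup ys))

module _ {m n} (σ : Permutation′ m) (τ : Permutation′ n) where

  relabel : EdgeSet m n → EdgeSet m n
  relabel F = tabulate λ i → tabulate λ j → Vec.lookup (Vec.lookup F (σ ⟨$⟩ˡ i)) (τ ⟨$⟩ˡ j)

  lookup-relabel : ∀ F i j →
    Vec.lookup (Vec.lookup (relabel F) i) j ≡ Vec.lookup (Vec.lookup F (σ ⟨$⟩ˡ i)) (τ ⟨$⟩ˡ j)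
  lookup-relabel F i j = trans (cong (λ row → Vec.lookup row j) (lookup∘tabulate _ i)) (lookup∘tabulate _ j)

  lookup-relabel-⟨$⟩ʳ : ∀ F i j →
    Vec.lookup (Vec.lookup (relabel F) (σ ⟨$⟩ʳ i)) (τ ⟨$⟩ʳ j) ≡ Vec.lookup (Vec.lookup F i) j
  lookup-relabel-⟨$⟩ʳ F i j = trans (lookup-relabel F _ _)
    (cong₂ (λ i′ j′ → Vec.lookup (Vec.lookup F i′) j′) (inverseˡ σ) (inverseˡ τ))

  relabel-injective : Injective _≡_ _≡_ relabel
  relabel-injective {F} {G} eq = EdgeSet-ext λ i j → begin
    Vec.lookup (Vec.lookup F i) j
      ≡⟨ lookup-relabel-⟨$⟩ʳ F i j ⟨
    Vec.lookup (Vec.lookup (relabel F) (σ ⟨$⟩ʳ i)) (τ ⟨$⟩ʳ j)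
      ≡⟨ cong (λ F′ → Vec.lookup (Vec.lookup F′ (σ ⟨$⟩ʳ i)) (τ ⟨$⟩ʳ j)) eq ⟩
    Vec.lookup (Vec.lookup (relabel G) (σ ⟨$⟩ʳ i)) (τ ⟨$⟩ʳ j)
      ≡⟨ lookup-relabel-⟨$⟩ʳ G i j ⟩
    Vec.lookup (Vec.lookup G i) j
      ∎
    where open ≡-Reasoning

  relabelEdge : Edge m n → Edge m n
  relabelEdge (i , j) = σ ⟨$⟩ʳ i , τ ⟨$⟩ʳ j

  ∈E-relabel : ∀ {F e} → e ∈E F → relabelEdge e ∈E relabel F
  ∈E-relabel {F} {i , j} = trans (lookup-relabel-⟨$⟩ʳ F i j)

  relabelVertex unrelabelVertex : Vertex m n → Vertex m n
  relabelVertex   = Sum.map (σ ⟨$⟩ʳ_) (τ ⟨$⟩ʳ_)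
  unrelabelVertex = Sum.map (σ ⟨$⟩ˡ_) (τ ⟨$⟩ˡ_)

  unrelabel-relabel : ∀ v → unrelabelVertex (relabelVertex v) ≡ v
  unrelabel-relabel (inj₁ i) = cong inj₁ (inverseˡ σ)
  unrelabel-relabel (inj₂ j) = cong inj₂ (inverseˡ τ)

  relabel-unrelabel : ∀ v → relabelVertex (unrelabelVertex v) ≡ v
  relabel-unrelabel (inj₁ i) = cong inj₁ (Perm.inverseʳ σ)
  relabel-unrelabel (inj₂ j) = cong inj₂ (Perm.inverseʳ τ)

  relabel-adj : ∀ {F u v} → Adj F u v → Adj (relabel F) (relabelVertex u) (relabelVertex v)
  relabel-adj {u = inj₁ _} {inj₁ _} ()
  relabel-adj {F} {inj₁ i} {inj₂ j} = ∈E-relabel {F} {i , j}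
  relabel-adj {F} {inj₂ j} {inj₁ i} = ∈E-relabel {F} {i , j}
  relabel-adj {u = inj₂ _} {inj₂ _} ()

  unrelabel-adj : ∀ {F u v} → Adj (relabel F) u v → Adj F (unrelabelVertex u) (unrelabelVertex v)
  unrelabel-adj {u = inj₁ _} {inj₁ _} ()
  unrelabel-adj {F} {inj₁ i} {inj₂ j} = trans (sym (lookup-relabel F i j))
  unrelabel-adj {F} {inj₂ j} {inj₁ i} = trans (sym (lookup-relabel F i j))
  unrelabel-adj {u = inj₂ _} {inj₂ _} ()

  IsForestK-relabel : ∀ {k F} → IsForestK k F → IsForestK k (relabel F)
  IsForestK-relabel = IsForestK-transport relabelVertex unrelabelVertex
    unrelabel-relabel relabel-unrelabel relabel-adj unrelabel-adj

ForestsThrough : ∀ {m n} → ℕ → Edge m n → Edge m n → EdgeSet m n → Set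
ForestsThrough k e e′ F = IsForestK k F × e ∈E F × e′ ∈E F

pairCount-≤ : ∀ {m n k} (σ : Permutation′ m) (τ : Permutation′ n) {e₁ e₂ e₁′ e₂′ c c′} →
  relabelEdge σ τ e₁ ≡ e₁′ → relabelEdge σ τ e₂ ≡ e₂′ →
  IsCount (ForestsThrough k e₁ e₂) c → IsCount (ForestsThrough k e₁′ e₂′) c′ → c ℕ.≤ c′
pairCount-≤ σ τ {e₁} {e₂} refl refl = IsCount-≤ (relabel σ τ) (relabel-injective σ τ) λ where
  F (forest , e₁∈F , e₂∈F) →
    IsForestK-relabel σ τ forest , ∈E-relabel σ τ {F} {e₁} e₁∈F , ∈E-relabel σ τ {F} {e₂} e₂∈F

pairCount-relabel : ∀ {m n k} (σ : Permutation′ m) (τ : Permutation′ n) {e₁ e₂ e₁′ e₂′ c c′} →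
  relabelEdge σ τ e₁ ≡ e₁′ → relabelEdge σ τ e₂ ≡ e₂′ →
  IsCount (ForestsThrough k e₁ e₂) c → IsCount (ForestsThrough k e₁′ e₂′) c′ → c ≡ c′
pairCount-relabel σ τ σe₁ σe₂ C C′ = ≤-antisym
  (pairCount-≤ σ τ σe₁ σe₂ C C′)
  (pairCount-≤ (Perm.flip σ) (Perm.flip τ) (unrelabel σe₁) (unrelabel σe₂) C′ C)
  where
  unrelabel : ∀ {e e′} → relabelEdge σ τ e ≡ e′ → relabelEdge (Perm.flip σ) (Perm.flip τ) e′ ≡ e
  unrelabel refl = cong₂ _,_ (inverseˡ σ) (inverseˡ τ)

-- Both send 0 to i by computation.
sending₀ : ∀ {k} (i : Fin (suc k)) → Permutation′ (suc k)
sending₀ i = insert zero i Perm.id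

sending₀₁ : ∀ {k} (i i′ : Fin (suc (suc k))) → i ≢ i′ → Permutation′ (suc (suc k))
sending₀₁ i i′ i≢i′ = insert zero i (insert zero (punchOut i≢i′) Perm.id)

sending₀₁-1 : ∀ {k} {i i′ : Fin (suc (suc k))} (i≢i′ : i ≢ i′) →
  sending₀₁ i i′ i≢i′ ⟨$⟩ʳ suc zero ≡ i′
sending₀₁-1 = punchIn-punchOut

module _ {a b k : ℕ} {H : Edge (suc (suc a)) (suc (suc b)) → Edge (suc (suc a)) (suc (suc b)) → ℕ}
         (hessian : IsHessianAtOnes k H) where

  H-diagonal : ∀ e → H e e ≡ 0
  H-diagonal e = proj₁ (hessian e e) refl

  H-sameRow : ∀ {p} → IsCount (ForestsThrough k (zero , zero) (zero , suc zero)) p →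
    ∀ i {j j′} (j≢j′ : j ≢ j′) → H (i , j) (i , j′) ≡ p
  H-sameRow Cp i j≢j′ = sym (pairCount-relabel (sending₀ i) (sending₀₁ _ _ j≢j′)
    refl (cong (i ,_) (sending₀₁-1 j≢j′)) Cp (proj₂ (hessian _ _) (j≢j′ ∘ cong proj₂)))

  H-sameColumn : ∀ {q} → IsCount (ForestsThrough k (zero , zero) (suc zero , zero)) q →
    ∀ {i i′} j (i≢i′ : i ≢ i′) → H (i , j) (i′ , j) ≡ q
  H-sameColumn Cq j i≢i′ = sym (pairCount-relabel (sending₀₁ _ _ i≢i′) (sending₀ j)
    refl (cong (_, j) (sending₀₁-1 i≢i′)) Cq (proj₂ (hessian _ _) (i≢i′ ∘ cong proj₁)))

  H-disjoint : ∀ {r} → IsCount (ForestsThrough k (zero , zero) (suc zero , suc zero)) r →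
    ∀ {i i′ j j′} (i≢i′ : i ≢ i′) (j≢j′ : j ≢ j′) → H (i , j) (i′ , j′) ≡ r
  H-disjoint Cr i≢i′ j≢j′ = sym (pairCount-relabel (sending₀₁ _ _ i≢i′) (sending₀₁ _ _ j≢j′)
    refl (cong₂ _,_ (sending₀₁-1 i≢i′) (sending₀₁-1 j≢j′))
    Cr (proj₂ (hessian _ _) (i≢i′ ∘ cong proj₁)))

module Spectrum where
  open import Data.Rational using (_+_; _*_; _-_; -_; 1/_; mkℚ; NonZero)
  open import Data.Rational.Properties
    using ( +-identityˡ; +-identityʳ; +-assoc; +-inverseʳ; *-zeroˡ; *-zeroʳ; *-identityˡ; *-identityʳ
          ; *-comm; *-assoc; *-distribʳ-+; neg-distrib-+; *-inverseʳ; ↥p/↧p≡p; +-*-commutativeRing )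
    renaming (_≟_ to _≟ℚ_)
  open import Algebra.Properties.Semiring.Sum (CommutativeRing.semiring +-*-commutativeRing)
    using ( sum; sum-syntax; sum-cong-≗; sum-replicate-zero; ∑-distrib-+; ∑-comm
          ; *-distribˡ-sum; *-distribʳ-sum )
  import Data.Integer as ℤ
  import Data.Integer.Properties as ℤ
  import Data.Nat.Coprimality as Coprime
  open import Relation.Nullary.Decidable using (dec⇒maybe)
  open import Tactic.RingSolver using (solve-∀)
  open import Tactic.RingSolver.Core.AlmostCommutativeRing using (AlmostCommutativeRing; fromCommutativeRing)
  open ≡-Reasoning

  ℚ-ring : AlmostCommutativeRing _ _
  ℚ-ring = fromCommutativeRing +-*-commutativeRing (λ x → dec⇒maybe (0ℚ ≟ℚ x))

  ℕtoℚ≡mkℚ : ∀ k → ℕtoℚ k ≡ mkℚ (ℤ.+ k) 0 (Coprime.sym (Coprime.1-coprimeTo k))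
  ℕtoℚ≡mkℚ k = ↥p/↧p≡p (mkℚ (ℤ.+ k) 0 _)

  -- Once ℕtoℚ k is in normal form, 1ℚ + ℕtoℚ k computes to (1 + k * 1) / 1.
  ℕtoℚ-suc : ∀ k → ℕtoℚ (suc k) ≡ 1ℚ + ℕtoℚ k
  ℕtoℚ-suc k rewrite ℕtoℚ≡mkℚ k =
    cong (λ z → (ℤ.1ℤ ℤ.+ z) ℚ./ 1) (sym (ℤ.*-identityʳ (ℤ.+ k)))

  ℕtoℚ-+ : ∀ a b → ℕtoℚ (a ℕ.+ b) ≡ ℕtoℚ a + ℕtoℚ b
  ℕtoℚ-+ zero    b = sym (+-identityˡ (ℕtoℚ b))
  ℕtoℚ-+ (suc a) b = begin
    ℕtoℚ (suc (a ℕ.+ b))    ≡⟨ ℕtoℚ-suc (a ℕ.+ b) ⟩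
    1ℚ + ℕtoℚ (a ℕ.+ b)     ≡⟨ cong (1ℚ +_) (ℕtoℚ-+ a b) ⟩
    1ℚ + (ℕtoℚ a + ℕtoℚ b)  ≡⟨ +-assoc 1ℚ (ℕtoℚ a) (ℕtoℚ b) ⟨
    (1ℚ + ℕtoℚ a) + ℕtoℚ b  ≡⟨ cong (_+ ℕtoℚ b) (ℕtoℚ-suc a) ⟨
    ℕtoℚ (suc a) + ℕtoℚ b   ∎

  ℕtoℚ-* : ∀ a b → ℕtoℚ (a ℕ.* b) ≡ ℕtoℚ a * ℕtoℚ b
  ℕtoℚ-* zero    b = sym (*-zeroˡ (ℕtoℚ b))
  ℕtoℚ-* (suc a) b = begin
    ℕtoℚ (b ℕ.+ a ℕ.* b)           ≡⟨ ℕtoℚ-+ b (a ℕ.* b) ⟩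
    ℕtoℚ b + ℕtoℚ (a ℕ.* b)        ≡⟨ cong (ℕtoℚ b +_) (ℕtoℚ-* a b) ⟩
    ℕtoℚ b + ℕtoℚ a * ℕtoℚ b       ≡⟨ cong (_+ ℕtoℚ a * ℕtoℚ b) (*-identityˡ (ℕtoℚ b)) ⟨
    1ℚ * ℕtoℚ b + ℕtoℚ a * ℕtoℚ b  ≡⟨ *-distribʳ-+ (ℕtoℚ b) 1ℚ (ℕtoℚ a) ⟨
    (1ℚ + ℕtoℚ a) * ℕtoℚ b         ≡⟨ cong (_* ℕtoℚ b) (ℕtoℚ-suc a) ⟨
    ℕtoℚ (suc a) * ℕtoℚ b          ∎

  ℕtoℚ-suc-nonZero : ∀ k → NonZero (ℕtoℚ (suc k))
  ℕtoℚ-suc-nonZero k = subst NonZero (sym (ℕtoℚ≡mkℚ (suc k))) _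

  1/suc : ℕ → ℚ
  1/suc k = (1/ ℕtoℚ (suc k)) {{ℕtoℚ-suc-nonZero k}}

  ℕtoℚ-suc-*-1/suc : ∀ k → ℕtoℚ (suc k) * 1/suc k ≡ 1ℚ
  ℕtoℚ-suc-*-1/suc k = *-inverseʳ (ℕtoℚ (suc k)) {{ℕtoℚ-suc-nonZero k}}

  ΣFin≡sum : ∀ k (f : Fin k → ℚ) → ΣFin k f ≡ sum f
  ΣFin≡sum zero    f = refl
  ΣFin≡sum (suc k) f = cong (f zero +_) (ΣFin≡sum k (f ∘ suc))

  ∑-scale : ∀ {k} c (f : Fin k → ℚ) → ∑[ i < k ] (c * f i) ≡ c * sum f
  ∑-scale c f = sym (*-distribˡ-sum c f)

  ∑-const : ∀ k c → ∑[ i < k ] c ≡ ℕtoℚ k * c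
  ∑-const zero    c = sym (*-zeroˡ c)
  ∑-const (suc k) c = begin
    c + ∑[ i < k ] c     ≡⟨ cong (c +_) (∑-const k c) ⟩
    c + ℕtoℚ k * c       ≡⟨ cong (_+ ℕtoℚ k * c) (*-identityˡ c) ⟨
    1ℚ * c + ℕtoℚ k * c  ≡⟨ *-distribʳ-+ c 1ℚ (ℕtoℚ k) ⟨
    (1ℚ + ℕtoℚ k) * c    ≡⟨ cong (_* c) (ℕtoℚ-suc k) ⟨
    ℕtoℚ (suc k) * c     ∎

  ∑-neg : ∀ {k} (f : Fin k → ℚ) → ∑[ i < k ] (- f i) ≡ - sum f
  ∑-neg {zero}  f = refl
  ∑-neg {suc k} f = trans (cong (- f zero +_) (∑-neg (f ∘ suc))) (sym (neg-distrib-+ (f zero) _))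

  ∑-distrib-- : ∀ {k} (f g : Fin k → ℚ) → ∑[ i < k ] (f i - g i) ≡ sum f - sum g
  ∑-distrib-- f g = trans (∑-distrib-+ f (-_ ∘ g)) (cong (sum f +_) (∑-neg g))

  ∑-++ : ∀ a b (f : Fin (a ℕ.+ b) → ℚ) → sum f ≡ ∑[ i < a ] f (i ↑ˡ b) + ∑[ j < b ] f (a ↑ʳ j)
  ∑-++ zero    b f = sym (+-identityˡ (sum f))
  ∑-++ (suc a) b f = trans (cong (f zero +_) (∑-++ a b (f ∘ suc))) (sym (+-assoc (f zero) _ _))

  ∑-combine : ∀ a b (f : Fin (a ℕ.* b) → ℚ) → sum f ≡ ∑[ i < a ] ∑[ j < b ] f (combine i j)
  ∑-combine zero    b f = refl
  ∑-combine (suc a) b f =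
    trans (∑-++ b (a ℕ.* b) f) (cong (∑[ j < b ] f (j ↑ˡ a ℕ.* b) +_) (∑-combine a b (f ∘ (b ↑ʳ_))))

  -- The complete graph: δ is the identity matrix and κ = J − I the adjacency matrix

  δ : ∀ {k} → Fin k → Fin k → ℚ
  δ zero    zero    = 1ℚ
  δ zero    (suc _) = 0ℚ
  δ (suc _) zero    = 0ℚ
  δ (suc i) (suc j) = δ i j

  κ : ∀ {k} → Fin k → Fin k → ℚ
  κ i j = 1ℚ - δ i j

  δ-refl : ∀ {k} (i : Fin k) → δ i i ≡ 1ℚ
  δ-refl zero    = refl
  δ-refl (suc i) = δ-refl i

  δ-≢ : ∀ {k} {i j : Fin k} → i ≢ j → δ i j ≡ 0ℚ
  δ-≢ {i = zero}  {zero}  i≢j = ⊥-elim (i≢j refl)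
  δ-≢ {i = zero}  {suc j} _   = refl
  δ-≢ {i = suc i} {zero}  _   = refl
  δ-≢ {i = suc i} {suc j} i≢j = δ-≢ (i≢j ∘ cong suc)

  δ-sym : ∀ {k} (i j : Fin k) → δ i j ≡ δ j i
  δ-sym zero    zero    = refl
  δ-sym zero    (suc _) = refl
  δ-sym (suc _) zero    = refl
  δ-sym (suc i) (suc j) = δ-sym i j

  ∑-δ : ∀ {k} (s : Fin k) (f : Fin k → ℚ) → ∑[ i < k ] (δ s i * f i) ≡ f s
  ∑-δ {suc k} zero f = begin
    1ℚ * f zero + ∑[ i < k ] (0ℚ * f (suc i))
      ≡⟨ cong₂ _+_ (*-identityˡ (f zero)) (sum-cong-≗ (λ i → *-zeroˡ (f (suc i)))) ⟩
    f zero + ∑[ i < k ] 0ℚ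
      ≡⟨ cong (f zero +_) (sum-replicate-zero k) ⟩
    f zero + 0ℚ
      ≡⟨ +-identityʳ (f zero) ⟩
    f zero
      ∎
  ∑-δ {suc k} (suc s) f = trans (cong₂ _+_ (*-zeroˡ (f zero)) (∑-δ s (f ∘ suc))) (+-identityˡ (f (suc s)))

  ∑-δ≡1 : ∀ {k} (s : Fin k) → ∑[ i < k ] δ s i ≡ 1ℚ
  ∑-δ≡1 s = trans (sum-cong-≗ (λ i → sym (*-identityʳ (δ s i)))) (∑-δ s (λ _ → 1ℚ))

  ∑-[c-δ]* : ∀ {k} c (s : Fin k) (f : Fin k → ℚ) → ∑[ i < k ] ((c - δ s i) * f i) ≡ c * sum f - f s
  ∑-[c-δ]* {k} c s f = begin
    ∑[ i < k ] ((c - δ s i) * f i)                   ≡⟨ sum-cong-≗ (λ i → distrib c (δ s i) (f i)) ⟩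
    ∑[ i < k ] (c * f i - δ s i * f i)               ≡⟨ ∑-distrib-- (λ i → c * f i) (λ i → δ s i * f i) ⟩
    ∑[ i < k ] (c * f i) - ∑[ i < k ] (δ s i * f i)  ≡⟨ cong₂ _-_ (∑-scale c f) (∑-δ s f) ⟩
    c * sum f - f s                                  ∎
    where
    distrib : ∀ c d x → (c - d) * x ≡ c * x - d * x
    distrib = solve-∀ ℚ-ring

  ∑-κ : ∀ {k} (s : Fin k) (f : Fin k → ℚ) → ∑[ i < k ] (κ s i * f i) ≡ sum f - f s
  ∑-κ s f = trans (∑-[c-δ]* 1ℚ s f) (cong (_- f s) (*-identityˡ (sum f)))

  -- An eigenbasis of κ, with eigenvalues μ, and its dual basis φ⋆.

  φ : ∀ {k} → Fin (suc k) → Fin (suc k) → ℚ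
  φ zero    _ = 1ℚ
  φ (suc a) x = δ zero x - δ (suc a) x

  μ : ∀ {k} → Fin (suc k) → ℚ
  μ {k} zero = ℕtoℚ k
  μ (suc _)  = - 1ℚ

  φ⋆ : ∀ {k} → Fin (suc k) → Fin (suc k) → ℚ
  φ⋆ {k} zero    _ = 1/suc k
  φ⋆ {k} (suc a) y = 1/suc k - δ (suc a) y

  ∑-φ-zero : ∀ {k} → sum (φ {k} zero) ≡ ℕtoℚ (suc k)
  ∑-φ-zero {k} = trans (∑-const (suc k) 1ℚ) (*-identityʳ (ℕtoℚ (suc k)))

  ∑-φ-suc : ∀ {k} (a : Fin k) → sum (φ (suc a)) ≡ 0ℚ
  ∑-φ-suc {k} a = begin
    ∑[ x < suc k ] (δ zero x - δ (suc a) x)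
      ≡⟨ ∑-distrib-- (δ zero) (δ (suc a)) ⟩
    ∑[ x < suc k ] δ zero x - ∑[ x < suc k ] δ (suc a) x
      ≡⟨ cong₂ _-_ (∑-δ≡1 {suc k} zero) (∑-δ≡1 (suc a)) ⟩
    1ℚ - 1ℚ
      ≡⟨ +-inverseʳ 1ℚ ⟩
    0ℚ
      ∎

  κ-φ : ∀ {k} (s i : Fin (suc k)) → ∑[ x < suc k ] (κ i x * φ s x) ≡ μ s * φ s i
  κ-φ {k} s i = trans (∑-κ i (φ s)) (eigen s)
    where
    eigen : ∀ s → sum (φ s) - φ s i ≡ μ s * φ s i
    eigen zero = begin
      sum (φ {k} zero) - 1ℚ  ≡⟨ cong (_- 1ℚ) (trans (∑-φ-zero {k}) (ℕtoℚ-suc k)) ⟩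
      1ℚ + ℕtoℚ k - 1ℚ       ≡⟨ cancel (ℕtoℚ k) ⟩
      ℕtoℚ k * 1ℚ            ∎
      where
      cancel : ∀ x → 1ℚ + x - 1ℚ ≡ x * 1ℚ
      cancel = solve-∀ ℚ-ring
    eigen (suc a) = trans (cong (_- φ (suc a) i) (∑-φ-suc a)) (negate (φ (suc a) i))
      where
      negate : ∀ x → 0ℚ - x ≡ - 1ℚ * x
      negate = solve-∀ ℚ-ring

  1/suc-*-∑-φ : ∀ {k} (t : Fin (suc k)) → 1/suc k * sum (φ t) ≡ δ zero t
  1/suc-*-∑-φ {k} zero =
    trans (cong (1/suc k *_) (∑-φ-zero {k})) (trans (*-comm (1/suc k) _) (ℕtoℚ-suc-*-1/suc k))
  1/suc-*-∑-φ {k} (suc b) = trans (cong (1/suc k *_) (∑-φ-suc b)) (*-zeroʳ (1/suc k))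

  φ⋆-φ : ∀ {k} (s t : Fin (suc k)) → ∑[ x < suc k ] (φ⋆ s x * φ t x) ≡ δ s t
  φ⋆-φ {k} zero    t = trans (∑-scale (1/suc k) (φ t)) (1/suc-*-∑-φ t)
  φ⋆-φ {k} (suc a) t = begin
    ∑[ x < suc k ] ((1/suc k - δ (suc a) x) * φ t x)  ≡⟨ ∑-[c-δ]* (1/suc k) (suc a) (φ t) ⟩
    1/suc k * sum (φ t) - φ t (suc a)                 ≡⟨ cong (_- φ t (suc a)) (1/suc-*-∑-φ t) ⟩
    δ zero t - φ t (suc a)                            ≡⟨ value t ⟩
    δ (suc a) t                                       ∎
    where
    cancel : ∀ x → 0ℚ - (0ℚ - x) ≡ x
    cancel = solve-∀ ℚ-ring
    value : ∀ t → δ zero t - φ t (suc a) ≡ δ (suc a) t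
    value zero    = +-inverseʳ 1ℚ
    value (suc b) = trans (cancel (δ b a)) (δ-sym b a)

  φ-φ⋆ : ∀ {k} (x y : Fin (suc k)) → ∑[ s < suc k ] (φ s x * φ⋆ s y) ≡ δ x y
  φ-φ⋆ {k} zero y = begin
    1ℚ * w + ∑[ a < k ] ((1ℚ - 0ℚ) * (w - δ (suc a) y))
      ≡⟨ cong (1ℚ * w +_) (sum-cong-≗ (λ a → unit (w - δ (suc a) y))) ⟩
    1ℚ * w + ∑[ a < k ] (w - δ (suc a) y)
      ≡⟨ cong (1ℚ * w +_) (∑-distrib-- (λ _ → w) (λ a → δ (suc a) y)) ⟩
    1ℚ * w + (∑[ a < k ] w - S)
      ≡⟨ cong (λ z → 1ℚ * w + (z - S)) (∑-const k w) ⟩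
    1ℚ * w + (ℕtoℚ k * w - S)
      ≡⟨ regroup w (ℕtoℚ k) S ⟩
    (1ℚ + ℕtoℚ k) * w - S
      ≡⟨ cong (λ z → z * w - S) (ℕtoℚ-suc k) ⟨
    ℕtoℚ (suc k) * w - S
      ≡⟨ cong (_- S) (ℕtoℚ-suc-*-1/suc k) ⟩
    1ℚ - S
      ≡⟨ cong (_- S) (trans (sym (∑-δ≡1 y)) (sum-cong-≗ (δ-sym y))) ⟩
    δ zero y + S - S
      ≡⟨ cancel (δ zero y) S ⟩
    δ zero y
      ∎
    where
    w = 1/suc k
    S = ∑[ a < k ] δ (suc a) y
    unit : ∀ x → (1ℚ - 0ℚ) * x ≡ x
    unit = solve-∀ ℚ-ring
    regroup : ∀ w K S → 1ℚ * w + (K * w - S) ≡ (1ℚ + K) * w - S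
    regroup = solve-∀ ℚ-ring
    cancel : ∀ d S → d + S - S ≡ d
    cancel = solve-∀ ℚ-ring
  φ-φ⋆ {k} (suc c) y = begin
    1ℚ * w + ∑[ a < k ] ((0ℚ - δ a c) * (w - δ (suc a) y))
      ≡⟨ cong (1ℚ * w +_) (sum-cong-≗ λ a →
           trans (negate (δ a c) (w - δ (suc a) y)) (cong (λ d → - (d * (w - δ (suc a) y))) (δ-sym a c))) ⟩
    1ℚ * w + ∑[ a < k ] (- (δ c a * (w - δ (suc a) y)))
      ≡⟨ cong (1ℚ * w +_) (∑-neg (λ a → δ c a * (w - δ (suc a) y))) ⟩
    1ℚ * w + - ∑[ a < k ] (δ c a * (w - δ (suc a) y))
      ≡⟨ cong (λ z → 1ℚ * w + - z) (∑-δ c (λ a → w - δ (suc a) y)) ⟩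
    1ℚ * w + - (w - δ (suc c) y)
      ≡⟨ cancel w (δ (suc c) y) ⟩
    δ (suc c) y
      ∎
    where
    w = 1/suc k
    negate : ∀ d x → (0ℚ - d) * x ≡ - (d * x)
    negate = solve-∀ ℚ-ring
    cancel : ∀ w d → 1ℚ * w + - (w - d) ≡ d
    cancel = solve-∀ ℚ-ring

  -- Tensor products and the flattened basis

  ∑E : ∀ {m n} → (Edge m n → ℚ) → ℚ
  ∑E {m} {n} f = ∑[ i < m ] ∑[ j < n ] f (i , j)

  ΣEdge≡∑E : ∀ {m n} (f : Edge m n → ℚ) → ΣEdge f ≡ ∑E f
  ΣEdge≡∑E {m} {n} f = trans (ΣFin≡sum m (λ i → ΣFin n (λ j → f (i , j))))
                             (sum-cong-≗ (λ i → ΣFin≡sum n (λ j → f (i , j))))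

  ∑E-cong : ∀ {m n} {f g : Edge m n → ℚ} → (∀ e → f e ≡ g e) → ∑E f ≡ ∑E g
  ∑E-cong f≗g = sum-cong-≗ (λ i → sum-cong-≗ (λ j → f≗g (i , j)))

  ∑E-scale : ∀ {m n} c (f : Edge m n → ℚ) → ∑E (λ e → c * f e) ≡ c * ∑E f
  ∑E-scale {m} {n} c f =
    trans (sum-cong-≗ (λ i → ∑-scale c (λ j → f (i , j)))) (∑-scale c (λ i → ∑[ j < n ] f (i , j)))

  ∑E-+ : ∀ {m n} (f g : Edge m n → ℚ) → ∑E (λ e → f e + g e) ≡ ∑E f + ∑E g
  ∑E-+ {m} {n} f g = trans (sum-cong-≗ (λ i → ∑-distrib-+ (λ j → f (i , j)) (λ j → g (i , j))))
    (∑-distrib-+ (λ i → ∑[ j < n ] f (i , j)) (λ i → ∑[ j < n ] g (i , j)))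

  ∑E-comm : ∀ {m n m′ n′} (f : Edge m n → Edge m′ n′ → ℚ) →
    ∑E (λ e → ∑E (λ e′ → f e e′)) ≡ ∑E (λ e′ → ∑E (λ e → f e e′))
  ∑E-comm {m} {n} {m′} {n′} f = begin
    ∑[ i < m ] ∑[ j < n ] ∑[ i′ < m′ ] ∑[ j′ < n′ ] f (i , j) (i′ , j′)
      ≡⟨ sum-cong-≗ (λ i → ∑-comm (λ j i′ → ∑[ j′ < n′ ] f (i , j) (i′ , j′))) ⟩
    ∑[ i < m ] ∑[ i′ < m′ ] ∑[ j < n ] ∑[ j′ < n′ ] f (i , j) (i′ , j′)
      ≡⟨ ∑-comm (λ i i′ → ∑[ j < n ] ∑[ j′ < n′ ] f (i , j) (i′ , j′)) ⟩
    ∑[ i′ < m′ ] ∑[ i < m ] ∑[ j < n ] ∑[ j′ < n′ ] f (i , j) (i′ , j′)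
      ≡⟨ sum-cong-≗ (λ i′ → sum-cong-≗ (λ i → ∑-comm (λ j j′ → f (i , j) (i′ , j′)))) ⟩
    ∑[ i′ < m′ ] ∑[ i < m ] ∑[ j′ < n′ ] ∑[ j < n ] f (i , j) (i′ , j′)
      ≡⟨ sum-cong-≗ (λ i′ → ∑-comm (λ i j′ → ∑[ j < n ] f (i , j) (i′ , j′))) ⟩
    ∑[ i′ < m′ ] ∑[ j′ < n′ ] ∑[ i < m ] ∑[ j < n ] f (i , j) (i′ , j′)
      ∎

  ∑E-⊗ : ∀ {m n} (a u : Fin m → ℚ) (b v : Fin n → ℚ) →
    ∑[ i < m ] ∑[ j < n ] ((a i * b j) * (u i * v j)) ≡ ∑[ i < m ] (a i * u i) * ∑[ j < n ] (b j * v j)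
  ∑E-⊗ {m} {n} a u b v = begin
    ∑[ i < m ] ∑[ j < n ] ((a i * b j) * (u i * v j))
      ≡⟨ ∑E-cong {m} {n} (λ (i , j) → interchange (a i) (b j) (u i) (v j)) ⟩
    ∑[ i < m ] ∑[ j < n ] ((a i * u i) * (b j * v j))
      ≡⟨ sum-cong-≗ (λ i → ∑-scale (a i * u i) (λ j → b j * v j)) ⟩
    ∑[ i < m ] ((a i * u i) * ∑[ j < n ] (b j * v j))
      ≡⟨ *-distribʳ-sum (∑[ j < n ] (b j * v j)) (λ i → a i * u i) ⟨
    ∑[ i < m ] (a i * u i) * ∑[ j < n ] (b j * v j)
      ∎
    where
    interchange : ∀ a b u v → (a * b) * (u * v) ≡ (a * u) * (b * v)
    interchange = solve-∀ ℚ-ring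

  δ₂ : ∀ {m n} → Edge m n → Edge m n → ℚ
  δ₂ (i , j) (i′ , j′) = δ i i′ * δ j j′

  ∑E-δ₂ : ∀ {m n} (e : Edge m n) (f : Edge m n → ℚ) → ∑E (λ e′ → δ₂ e e′ * f e′) ≡ f e
  ∑E-δ₂ {m} {n} (s , t) f = begin
    ∑[ i < m ] ∑[ j < n ] ((δ s i * δ t j) * f (i , j))
      ≡⟨ sum-cong-≗ (λ i → trans (sum-cong-≗ (λ j → *-assoc (δ s i) (δ t j) (f (i , j))))
                                 (∑-scale (δ s i) (λ j → δ t j * f (i , j)))) ⟩
    ∑[ i < m ] (δ s i * ∑[ j < n ] (δ t j * f (i , j)))
      ≡⟨ sum-cong-≗ (λ i → cong (δ s i *_) (∑-δ t (λ j → f (i , j)))) ⟩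
    ∑[ i < m ] (δ s i * f (i , t))
      ≡⟨ ∑-δ s (λ i → f (i , t)) ⟩
    f (s , t)
      ∎

  ⟨_,_⟩ : ∀ {m n} → QVec m n → QVec m n → ℚ
  ⟨ u , v ⟩ = ∑E (λ e → u e * v e)

  Φ Φ⋆ : ∀ {m n} → Edge (suc m) (suc n) → QVec (suc m) (suc n)
  Φ  (s , t) (i , j) = φ s i * φ t j
  Φ⋆ (s , t) (i , j) = φ⋆ s i * φ⋆ t j

  Φ⋆-Φ : ∀ {m n} (p q : Edge (suc m) (suc n)) → ⟨ Φ⋆ p , Φ q ⟩ ≡ δ₂ p q
  Φ⋆-Φ (s , t) (s′ , t′) =
    trans (∑E-⊗ (φ⋆ s) (φ s′) (φ⋆ t) (φ t′)) (cong₂ _*_ (φ⋆-φ s s′) (φ⋆-φ t t′))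

  Φ-Φ⋆ : ∀ {m n} (e e′ : Edge (suc m) (suc n)) → ∑E (λ p → Φ p e * Φ⋆ p e′) ≡ δ₂ e e′
  Φ-Φ⋆ (i , j) (i′ , j′) =
    trans (∑E-⊗ (λ s → φ s i) (λ s → φ⋆ s i′) (λ t → φ t j) (λ t → φ⋆ t j′))
          (cong₂ _*_ (φ-φ⋆ i i′) (φ-φ⋆ j j′))

  Φ-independent : ∀ {m n} (c : Edge (suc m) (suc n) → ℚ) →
    (∀ e → ∑E (λ p → c p * Φ p e) ≡ 0ℚ) → ∀ p → c p ≡ 0ℚ
  Φ-independent c vanishes p₀ = begin
    c p₀
      ≡⟨ ∑E-δ₂ p₀ c ⟨
    ∑E (λ p → δ₂ p₀ p * c p)
      ≡⟨ ∑E-cong (λ p → trans (cong (_* c p) (sym (Φ⋆-Φ p₀ p)))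
                              (*-comm ⟨ Φ⋆ p₀ , Φ p ⟩ (c p))) ⟩
    ∑E (λ p → c p * ⟨ Φ⋆ p₀ , Φ p ⟩)
      ≡⟨ ∑E-cong (λ p → ∑E-scale (c p) (λ e → Φ⋆ p₀ e * Φ p e)) ⟨
    ∑E (λ p → ∑E (λ e → c p * (Φ⋆ p₀ e * Φ p e)))
      ≡⟨ ∑E-comm (λ p e → c p * (Φ⋆ p₀ e * Φ p e)) ⟩
    ∑E (λ e → ∑E (λ p → c p * (Φ⋆ p₀ e * Φ p e)))
      ≡⟨ ∑E-cong (λ e → ∑E-cong (λ p → rearrange (c p) (Φ⋆ p₀ e) (Φ p e))) ⟩
    ∑E (λ e → ∑E (λ p → Φ⋆ p₀ e * (c p * Φ p e)))
      ≡⟨ ∑E-cong (λ e → ∑E-scale (Φ⋆ p₀ e) (λ p → c p * Φ p e)) ⟩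
    ∑E (λ e → Φ⋆ p₀ e * ∑E (λ p → c p * Φ p e))
      ≡⟨ ∑E-cong (λ e → trans (cong (Φ⋆ p₀ e *_) (vanishes e)) (*-comm (Φ⋆ p₀ e) 0ℚ)) ⟩
    ∑E (λ e → 0ℚ * Φ⋆ p₀ e)
      ≡⟨ trans (∑E-scale 0ℚ (Φ⋆ p₀)) (*-zeroˡ (∑E (Φ⋆ p₀))) ⟩
    0ℚ
      ∎
    where
    rearrange : ∀ c x y → c * (x * y) ≡ x * (c * y)
    rearrange = solve-∀ ℚ-ring

  Φ-spanning : ∀ {m n} (v : QVec (suc m) (suc n)) e → ∑E (λ p → ⟨ Φ⋆ p , v ⟩ * Φ p e) ≡ v e
  Φ-spanning v e = begin
    ∑E (λ p → ⟨ Φ⋆ p , v ⟩ * Φ p e)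
      ≡⟨ ∑E-cong (λ p → *-comm ⟨ Φ⋆ p , v ⟩ (Φ p e)) ⟩
    ∑E (λ p → Φ p e * ⟨ Φ⋆ p , v ⟩)
      ≡⟨ ∑E-cong (λ p → ∑E-scale (Φ p e) (λ e′ → Φ⋆ p e′ * v e′)) ⟨
    ∑E (λ p → ∑E (λ e′ → Φ p e * (Φ⋆ p e′ * v e′)))
      ≡⟨ ∑E-comm (λ p e′ → Φ p e * (Φ⋆ p e′ * v e′)) ⟩
    ∑E (λ e′ → ∑E (λ p → Φ p e * (Φ⋆ p e′ * v e′)))
      ≡⟨ ∑E-cong (λ e′ → ∑E-cong (λ p → rearrange (Φ p e) (Φ⋆ p e′) (v e′))) ⟩
    ∑E (λ e′ → ∑E (λ p → v e′ * (Φ p e * Φ⋆ p e′)))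
      ≡⟨ ∑E-cong (λ e′ → ∑E-scale (v e′) (λ p → Φ p e * Φ⋆ p e′)) ⟩
    ∑E (λ e′ → v e′ * ∑E (λ p → Φ p e * Φ⋆ p e′))
      ≡⟨ ∑E-cong (λ e′ → trans (cong (v e′ *_) (Φ-Φ⋆ e e′)) (*-comm (v e′) (δ₂ e e′))) ⟩
    ∑E (λ e′ → δ₂ e e′ * v e′)
      ≡⟨ ∑E-δ₂ e v ⟩
    v e
      ∎
    where
    rearrange : ∀ x y z → x * (y * z) ≡ z * (x * y)
    rearrange = solve-∀ ℚ-ring

  module _ {m n : ℕ} where

    interiorEdge : Fin (m ℕ.* n) → Edge (suc m) (suc n)
    interiorEdge z = suc (proj₁ (remQuot {m} n z)) , suc (proj₂ (remQuot {m} n z))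

    module _ {A : Set} (Ψ : Edge (suc m) (suc n) → A) where

      corner : Vector A 1
      corner _ = Ψ (zero , zero)

      column : Vector A m
      column a = Ψ (suc a , zero)

      row : Vector A n
      row b = Ψ (zero , suc b)

      interior : Vector A (m ℕ.* n)
      interior = Ψ ∘ interiorEdge

      flatten : Vector A (1 ℕ.+ (m ℕ.+ (n ℕ.+ m ℕ.* n)))
      flatten = corner ++ (column ++ (row ++ interior))

    flatIndex : Edge (suc m) (suc n) → Fin (1 ℕ.+ (m ℕ.+ (n ℕ.+ m ℕ.* n)))
    flatIndex (zero  , zero)  = zero
    flatIndex (suc a , zero)  = suc (a ↑ˡ (n ℕ.+ m ℕ.* n))
    flatIndex (zero  , suc b) = suc (m ↑ʳ (b ↑ˡ m ℕ.* n))
    flatIndex (suc a , suc b) = suc (m ↑ʳ (n ↑ʳ combine a b))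

    flatten-flatIndex : ∀ {A : Set} (Ψ : Edge (suc m) (suc n) → A) p → flatten Ψ (flatIndex p) ≡ Ψ p
    flatten-flatIndex Ψ (zero  , zero)  = refl
    flatten-flatIndex Ψ (suc a , zero)  = lookup-++ˡ (column Ψ) _ a
    flatten-flatIndex Ψ (zero  , suc b) = trans (lookup-++ʳ (column Ψ) _ (b ↑ˡ _)) (lookup-++ˡ (row Ψ) _ b)
    flatten-flatIndex Ψ (suc a , suc b) = begin
      (column Ψ ++ (row Ψ ++ interior Ψ)) (m ↑ʳ (n ↑ʳ combine a b))
        ≡⟨ lookup-++ʳ (column Ψ) _ _ ⟩
      (row Ψ ++ interior Ψ) (n ↑ʳ combine a b)
        ≡⟨ lookup-++ʳ (row Ψ) _ _ ⟩
      interior Ψ (combine a b)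
        ≡⟨ cong (Ψ ∘ Data.Product.map suc suc) (remQuot-combine a b) ⟩
      Ψ (suc a , suc b)
        ∎

    flatIndex⁻¹ : Fin (1 ℕ.+ (m ℕ.+ (n ℕ.+ m ℕ.* n))) → Edge (suc m) (suc n)
    flatIndex⁻¹ = flatten (λ p → p)

    flatIndex-flatIndex⁻¹ : ∀ k → flatIndex (flatIndex⁻¹ k) ≡ k
    flatIndex-flatIndex⁻¹ zero = refl
    flatIndex-flatIndex⁻¹ (suc k) with splitAt m k in split₁
    ... | inj₁ a = cong suc (splitAt⁻¹-↑ˡ split₁)
    ... | inj₂ k′ with splitAt n k′ in split₂
    ...   | inj₁ b = cong suc (trans (cong (m ↑ʳ_) (splitAt⁻¹-↑ˡ split₂)) (splitAt⁻¹-↑ʳ split₁))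
    ...   | inj₂ z = cong suc (trans (cong (m ↑ʳ_) (trans (cong (n ↑ʳ_) (combine-remQuot {m} n z))
                                                           (splitAt⁻¹-↑ʳ split₂)))
                                     (splitAt⁻¹-↑ʳ split₁))

    ∑-flatten : (g : Fin (1 ℕ.+ (m ℕ.+ (n ℕ.+ m ℕ.* n))) → ℚ) → sum g ≡ ∑E (g ∘ flatIndex)
    ∑-flatten g = begin
      g zero + ∑[ x < m ℕ.+ (n ℕ.+ m ℕ.* n) ] g (suc x)
        ≡⟨ cong (g zero +_) (∑-++ m (n ℕ.+ m ℕ.* n) (g ∘ suc)) ⟩
      g zero + (T₂ + ∑[ y < n ℕ.+ m ℕ.* n ] g (suc (m ↑ʳ y)))
        ≡⟨ cong (λ z → g zero + (T₂ + z)) (∑-++ n (m ℕ.* n) (g ∘ suc ∘ (m ↑ʳ_))) ⟩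
      g zero + (T₂ + (T₃ + ∑[ z < m ℕ.* n ] g (suc (m ↑ʳ (n ↑ʳ z)))))
        ≡⟨ cong (λ z → g zero + (T₂ + (T₃ + z))) (∑-combine m n (g ∘ suc ∘ (m ↑ʳ_) ∘ (n ↑ʳ_))) ⟩
      g zero + (T₂ + (T₃ + T₄))
        ≡⟨ regroup (g zero) T₂ T₃ T₄ ⟩
      (g zero + T₃) + (T₂ + T₄)
        ≡⟨ cong ((g zero + T₃) +_) (∑-distrib-+ (λ a → g (flatIndex (suc a , zero)))
                                                (λ a → ∑[ b < n ] g (flatIndex (suc a , suc b)))) ⟨
      ∑E (g ∘ flatIndex)
        ∎
      where
      T₂ = ∑[ a < m ] g (flatIndex (suc a , zero))
      T₃ = ∑[ b < n ] g (flatIndex (zero , suc b))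
      T₄ = ∑[ a < m ] ∑[ b < n ] g (flatIndex (suc a , suc b))
      regroup : ∀ x a b c → x + (a + (b + c)) ≡ (x + b) + (a + c)
      regroup = solve-∀ ℚ-ring

    lincomb-flatten : ∀ c (Ψ : Edge (suc m) (suc n) → QVec (suc m) (suc n)) e →
      lincomb c (flatten Ψ) e ≡ ∑E (λ p → c (flatIndex p) * Ψ p e)
    lincomb-flatten c Ψ e = begin
      lincomb c (flatten Ψ) e
        ≡⟨ ΣFin≡sum _ (λ k → c k * flatten Ψ k e) ⟩
      sum (λ k → c k * flatten Ψ k e)
        ≡⟨ ∑-flatten (λ k → c k * flatten Ψ k e) ⟩
      ∑E (λ p → c (flatIndex p) * flatten Ψ (flatIndex p) e)
        ≡⟨ ∑E-cong (λ p → cong (λ v → c (flatIndex p) * v e) (flatten-flatIndex Ψ p)) ⟩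
      ∑E (λ p → c (flatIndex p) * Ψ p e)
        ∎

    flatten-Φ-isBasis : IsBasis (flatten Φ)
    flatten-Φ-isBasis = independent , spanning
      where
      independent : LinIndep (flatten Φ)
      independent c vanishes k = begin
        c k                            ≡⟨ cong c (flatIndex-flatIndex⁻¹ k) ⟨
        c (flatIndex (flatIndex⁻¹ k))  ≡⟨ Φ-independent (c ∘ flatIndex) vanishes′ (flatIndex⁻¹ k) ⟩
        0ℚ                             ∎
        where
        vanishes′ : ∀ e → ∑E (λ p → c (flatIndex p) * Φ p e) ≡ 0ℚ
        vanishes′ e = trans (sym (lincomb-flatten c Φ e)) (vanishes e)
      spanning : Spans (flatten Φ)
      spanning v = coefficient , λ e → begin
        lincomb coefficient (flatten Φ) e
          ≡⟨ lincomb-flatten coefficient Φ e ⟩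
        ∑E (λ p → ⟨ Φ⋆ (flatIndex⁻¹ (flatIndex p)) , v ⟩ * Φ p e)
          ≡⟨ ∑E-cong (λ p → cong (λ q → ⟨ Φ⋆ q , v ⟩ * Φ p e) (flatten-flatIndex (λ q → q) p)) ⟩
        ∑E (λ p → ⟨ Φ⋆ p , v ⟩ * Φ p e)
          ≡⟨ Φ-spanning v e ⟩
        v e
          ∎
        where
        coefficient : Fin (1 ℕ.+ (m ℕ.+ (n ℕ.+ m ℕ.* n))) → ℚ
        coefficient k = ⟨ Φ⋆ (flatIndex⁻¹ k) , v ⟩

  -- The Hessian as P (I ⊗ κ) + Q (κ ⊗ I) + R (κ ⊗ κ)

  hessianModel : ∀ {m n} → ℚ → ℚ → ℚ → Edge m n → Edge m n → ℚ
  hessianModel P Q R (i , j) (i′ , j′) =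
    P * (δ i i′ * κ j j′) + Q * (κ i i′ * δ j j′) + R * (κ i i′ * κ j j′)

  eigenvalue : ∀ {m n} → ℚ → ℚ → ℚ → Edge (suc m) (suc n) → ℚ
  eigenvalue P Q R (s , t) = P * μ t + Q * μ s + R * (μ s * μ t)

  ∑E-linear : ∀ {m n} P Q R (f g h : Edge m n → ℚ) →
    ∑E (λ e → P * f e + Q * g e + R * h e) ≡ P * ∑E f + Q * ∑E g + R * ∑E h
  ∑E-linear P Q R f g h = begin
    ∑E (λ e → P * f e + Q * g e + R * h e)
      ≡⟨ ∑E-+ (λ e → P * f e + Q * g e) (λ e → R * h e) ⟩
    ∑E (λ e → P * f e + Q * g e) + ∑E (λ e → R * h e)
      ≡⟨ cong (_+ ∑E (λ e → R * h e)) (∑E-+ (λ e → P * f e) (λ e → Q * g e)) ⟩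
    ∑E (λ e → P * f e) + ∑E (λ e → Q * g e) + ∑E (λ e → R * h e)
      ≡⟨ cong₂ _+_ (cong₂ _+_ (∑E-scale P f) (∑E-scale Q g)) (∑E-scale R h) ⟩
    P * ∑E f + Q * ∑E g + R * ∑E h
      ∎

  hessianModel-Φ : ∀ {m n} P Q R (p e : Edge (suc m) (suc n)) →
    ∑E (λ e′ → hessianModel P Q R e e′ * Φ p e′) ≡ eigenvalue P Q R p * Φ p e
  hessianModel-Φ {m} {n} P Q R (s , t) (i , j) = begin
    ∑E (λ e′ → hessianModel P Q R (i , j) e′ * Φ (s , t) e′)
      ≡⟨ ∑E-cong (λ (i′ , j′) → distribute P Q R (δ i i′) (δ j j′) (Φ (s , t) (i′ , j′))) ⟩
    ∑E (λ e′ → P * term (δ i) (κ j) e′ + Q * term (κ i) (δ j) e′ + R * term (κ i) (κ j) e′)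
      ≡⟨ ∑E-linear P Q R (term (δ i) (κ j)) (term (κ i) (δ j)) (term (κ i) (κ j)) ⟩
    P * ∑E (term (δ i) (κ j)) + Q * ∑E (term (κ i) (δ j)) + R * ∑E (term (κ i) (κ j))
      ≡⟨ cong₂ _+_ (cong₂ _+_ (cong (P *_) (∑E-term (δ i) (κ j))) (cong (Q *_) (∑E-term (κ i) (δ j))))
                   (cong (R *_) (∑E-term (κ i) (κ j))) ⟩
    P * (∑[ x < suc m ] (δ i x * φ s x) * ∑[ y < suc n ] (κ j y * φ t y)) +
    Q * (∑[ x < suc m ] (κ i x * φ s x) * ∑[ y < suc n ] (δ j y * φ t y)) +
    R * (∑[ x < suc m ] (κ i x * φ s x) * ∑[ y < suc n ] (κ j y * φ t y))
      ≡⟨ cong₂ _+_ (cong₂ _+_ (cong (P *_) (cong₂ _*_ (∑-δ i (φ s)) (κ-φ t j)))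
                              (cong (Q *_) (cong₂ _*_ (κ-φ s i) (∑-δ j (φ t)))))
                   (cong (R *_) (cong₂ _*_ (κ-φ s i) (κ-φ t j))) ⟩
    P * (φ s i * (μ t * φ t j)) + Q * (μ s * φ s i * φ t j) + R * (μ s * φ s i * (μ t * φ t j))
      ≡⟨ collect P Q R (μ s) (μ t) (φ s i) (φ t j) ⟩
    eigenvalue P Q R (s , t) * Φ (s , t) (i , j)
      ∎
    where
    term : (Fin (suc m) → ℚ) → (Fin (suc n) → ℚ) → Edge (suc m) (suc n) → ℚ
    term a b (x , y) = (a x * b y) * Φ (s , t) (x , y)
    ∑E-term : ∀ a b → ∑E (term a b) ≡ ∑[ x < suc m ] (a x * φ s x) * ∑[ y < suc n ] (b y * φ t y)
    ∑E-term a b = ∑E-⊗ a (φ s) b (φ t)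
    distribute : ∀ P Q R d d′ w →
      (P * (d * (1ℚ - d′)) + Q * ((1ℚ - d) * d′) + R * ((1ℚ - d) * (1ℚ - d′))) * w ≡
      P * ((d * (1ℚ - d′)) * w) + Q * (((1ℚ - d) * d′) * w) + R * (((1ℚ - d) * (1ℚ - d′)) * w)
    distribute = solve-∀ ℚ-ring
    collect : ∀ P Q R a b x y →
      P * (x * (b * y)) + Q * (a * x * y) + R * (a * x * (b * y)) ≡ (P * b + Q * a + R * (a * b)) * (x * y)
    collect = solve-∀ ℚ-ring

  IsEigenvector-Φ : ∀ {m n} (H : Edge (suc m) (suc n) → Edge (suc m) (suc n) → ℕ) P Q R →
    (∀ e e′ → ℕtoℚ (H e e′) ≡ hessianModel P Q R e e′) →
    ∀ p → IsEigenvector H (eigenvalue P Q R p) (Φ p)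
  IsEigenvector-Φ H P Q R H≡model p e = begin
    ΣEdge (λ e′ → ℕtoℚ (H e e′) * Φ p e′)
      ≡⟨ ΣEdge≡∑E (λ e′ → ℕtoℚ (H e e′) * Φ p e′) ⟩
    ∑E (λ e′ → ℕtoℚ (H e e′) * Φ p e′)
      ≡⟨ ∑E-cong (λ e′ → cong (_* Φ p e′) (H≡model e e′)) ⟩
    ∑E (λ e′ → hessianModel P Q R e e′ * Φ p e′)
      ≡⟨ hessianModel-Φ P Q R p e ⟩
    eigenvalue P Q R p * Φ p e
      ∎

  module _ {m n : ℕ} (P Q R : ℚ) where

    private
      hessianModel-at : ∀ (i i′ : Fin m) (j j′ : Fin n) {x y} → δ i i′ ≡ x → δ j j′ ≡ y →
        hessianModel P Q R (i , j) (i′ , j′) ≡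
        P * (x * (1ℚ - y)) + Q * ((1ℚ - x) * y) + R * ((1ℚ - x) * (1ℚ - y))
      hessianModel-at _ _ _ _ =
        cong₂ (λ x y → P * (x * (1ℚ - y)) + Q * ((1ℚ - x) * y) + R * ((1ℚ - x) * (1ℚ - y)))

    hessianModel-diagonal : ∀ (e : Edge m n) → hessianModel P Q R e e ≡ 0ℚ
    hessianModel-diagonal (i , j) =
      trans (hessianModel-at i i j j (δ-refl i) (δ-refl j)) (value P Q R)
      where
      value : ∀ P Q R →
        P * (1ℚ * (1ℚ - 1ℚ)) + Q * ((1ℚ - 1ℚ) * 1ℚ) + R * ((1ℚ - 1ℚ) * (1ℚ - 1ℚ)) ≡ 0ℚ
      value = solve-∀ ℚ-ring

    hessianModel-sameRow : ∀ (i : Fin m) {j j′ : Fin n} → j ≢ j′ →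
      hessianModel P Q R (i , j) (i , j′) ≡ P
    hessianModel-sameRow i {j} {j′} j≢j′ =
      trans (hessianModel-at i i j j′ (δ-refl i) (δ-≢ j≢j′)) (value P Q R)
      where
      value : ∀ P Q R →
        P * (1ℚ * (1ℚ - 0ℚ)) + Q * ((1ℚ - 1ℚ) * 0ℚ) + R * ((1ℚ - 1ℚ) * (1ℚ - 0ℚ)) ≡ P
      value = solve-∀ ℚ-ring

    hessianModel-sameColumn : ∀ {i i′ : Fin m} (j : Fin n) → i ≢ i′ →
      hessianModel P Q R (i , j) (i′ , j) ≡ Q
    hessianModel-sameColumn {i} {i′} j i≢i′ =
      trans (hessianModel-at i i′ j j (δ-≢ i≢i′) (δ-refl j)) (value P Q R)
      where
      value : ∀ P Q R →
        P * (0ℚ * (1ℚ - 1ℚ)) + Q * ((1ℚ - 0ℚ) * 1ℚ) + R * ((1ℚ - 0ℚ) * (1ℚ - 1ℚ)) ≡ Q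
      value = solve-∀ ℚ-ring

    hessianModel-disjoint : ∀ {i i′ : Fin m} {j j′ : Fin n} → i ≢ i′ → j ≢ j′ →
      hessianModel P Q R (i , j) (i′ , j′) ≡ R
    hessianModel-disjoint {i} {i′} {j} {j′} i≢i′ j≢j′ =
      trans (hessianModel-at i i′ j j′ (δ-≢ i≢i′) (δ-≢ j≢j′)) (value P Q R)
      where
      value : ∀ P Q R →
        P * (0ℚ * (1ℚ - 0ℚ)) + Q * ((1ℚ - 0ℚ) * 0ℚ) + R * ((1ℚ - 0ℚ) * (1ℚ - 0ℚ)) ≡ R
      value = solve-∀ ℚ-ring

  module _ {a b k : ℕ} {H : Edge (suc (suc a)) (suc (suc b)) → Edge (suc (suc a)) (suc (suc b)) → ℕ}
           (hessian : IsHessianAtOnes k H) {p q r : ℕ}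
           (Cp : IsCount {suc (suc a)} {suc (suc b)} (ForestsThrough k (zero , zero) (zero , suc zero)) p)
           (Cq : IsCount {suc (suc a)} {suc (suc b)} (ForestsThrough k (zero , zero) (suc zero , zero)) q)
           (Cr : IsCount {suc (suc a)} {suc (suc b)} (ForestsThrough k (zero , zero) (suc zero , suc zero)) r)
           where

    private
      P Q R : ℚ
      P = ℕtoℚ p
      Q = ℕtoℚ q
      R = ℕtoℚ r

    H≡hessianModel : ∀ e e′ → ℕtoℚ (H e e′) ≡ hessianModel P Q R e e′
    H≡hessianModel (i , j) (i′ , j′) with i ≟ i′ | j ≟ j′
    ... | yes refl | yes refl = trans (cong ℕtoℚ (H-diagonal hessian (i , j)))
                                      (sym (hessianModel-diagonal P Q R (i , j)))
    ... | yes refl | no j≢j′  = trans (cong ℕtoℚ (H-sameRow hessian Cp i j≢j′))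
                                      (sym (hessianModel-sameRow P Q R i j≢j′))
    ... | no i≢i′  | yes refl = trans (cong ℕtoℚ (H-sameColumn hessian Cq j i≢i′))
                                      (sym (hessianModel-sameColumn P Q R j i≢i′))
    ... | no i≢i′  | no j≢j′  = trans (cong ℕtoℚ (H-disjoint hessian Cr i≢i′ j≢j′))
                                      (sym (hessianModel-disjoint P Q R i≢i′ j≢j′))

  module _ (m n p q r : ℕ) where

    private
      P Q R M N : ℚ
      P = ℕtoℚ p
      Q = ℕtoℚ q
      R = ℕtoℚ r
      M = ℕtoℚ m
      N = ℕtoℚ n

    eigenvalue-corner :
      eigenvalue {m} {n} P Q R (zero , zero) ≡ ℕtoℚ (n ℕ.* p ℕ.+ m ℕ.* q ℕ.+ m ℕ.* n ℕ.* r)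
    eigenvalue-corner
      rewrite ℕtoℚ-+ (n ℕ.* p ℕ.+ m ℕ.* q) (m ℕ.* n ℕ.* r) | ℕtoℚ-+ (n ℕ.* p) (m ℕ.* q)
            | ℕtoℚ-* n p | ℕtoℚ-* m q | ℕtoℚ-* (m ℕ.* n) r | ℕtoℚ-* m n
            = value P Q R M N
      where
      value : ∀ P Q R M N → P * N + Q * M + R * (M * N) ≡ N * P + M * Q + M * N * R
      value = solve-∀ ℚ-ring

    eigenvalue-column : ∀ i →
      eigenvalue {m} {n} P Q R (suc i , zero) ≡ ℕtoℚ (n ℕ.* p) - Q - ℕtoℚ (n ℕ.* r)
    eigenvalue-column _ rewrite ℕtoℚ-* n p | ℕtoℚ-* n r = value P Q R N
      where
      value : ∀ P Q R N → P * N + Q * - 1ℚ + R * (- 1ℚ * N) ≡ N * P - Q - N * R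
      value = solve-∀ ℚ-ring

    eigenvalue-row : ∀ j →
      eigenvalue {m} {n} P Q R (zero , suc j) ≡ - P + ℕtoℚ (m ℕ.* q) - ℕtoℚ (m ℕ.* r)
    eigenvalue-row _ rewrite ℕtoℚ-* m q | ℕtoℚ-* m r = value P Q R M
      where
      value : ∀ P Q R M → P * - 1ℚ + Q * M + R * (M * - 1ℚ) ≡ - P + M * Q - M * R
      value = solve-∀ ℚ-ring

    eigenvalue-interior : ∀ z → eigenvalue P Q R (interiorEdge {m} {n} z) ≡ - P - Q + R
    eigenvalue-interior _ = value P Q R
      where
      value : ∀ P Q R → P * - 1ℚ + Q * - 1ℚ + R * (- 1ℚ * - 1ℚ) ≡ - P - Q + R
      value = solve-∀ ℚ-ring

open Spectrum
open import Data.Nat using (_+_; _*_; _∸_; _≤_; _<_)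

proposition2p14 :
    ∀ (m n k : ℕ) (hm : 2 ≤ m) (hn : 2 ≤ n) → 0 < k → k < m + n ∸ 2 →
    ∀ (H : Edge m n → Edge m n → ℕ) → IsHessianAtOnes k H →
    ∀ (p q r : ℕ) →
    IsCount (λ F → IsForestK k F × (fin0 hm , fin0 hn) ∈E F × (fin0 hm , fin1 hn) ∈E F) p →
    IsCount (λ F → IsForestK k F × (fin0 hm , fin0 hn) ∈E F × (fin1 hm , fin0 hn) ∈E F) q →
    IsCount (λ F → IsForestK k F × (fin0 hm , fin0 hn) ∈E F × (fin1 hm , fin1 hn) ∈E F) r →
    Σ (Vector (QVec m n) 1) λ b₁ →
    Σ (Vector (QVec m n) (m ∸ 1)) λ b₂ →
    Σ (Vector (QVec m n) (n ∸ 1)) λ b₃ →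
    Σ (Vector (QVec m n) ((m ∸ 1) * (n ∸ 1))) λ b₄ →
      (∀ i → IsEigenvector H
         (ℕtoℚ ((n ∸ 1) * p + (m ∸ 1) * q + (m ∸ 1) * (n ∸ 1) * r)) (b₁ i)) ×
      (∀ i → IsEigenvector H
         (ℕtoℚ ((n ∸ 1) * p) ℚ.- ℕtoℚ q ℚ.- ℕtoℚ ((n ∸ 1) * r)) (b₂ i)) ×
      (∀ i → IsEigenvector H
         (ℚ.- ℕtoℚ p ℚ.+ ℕtoℚ ((m ∸ 1) * q) ℚ.- ℕtoℚ ((m ∸ 1) * r)) (b₃ i)) ×
      (∀ i → IsEigenvector H
         (ℚ.- ℕtoℚ p ℚ.- ℕtoℚ q ℚ.+ ℕtoℚ r) (b₄ i)) ×
      IsBasis (b₁ ++ (b₂ ++ (b₃ ++ b₄)))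
proposition2p14 (suc (suc a)) (suc (suc b)) k (s≤s (s≤s z≤n)) (s≤s (s≤s z≤n)) _ _
                H hessian p q r Cp Cq Cr =
  corner Φ , column Φ , row Φ , interior Φ ,
  (λ _ → eigenvector (zero , zero) (eigenvalue-corner (suc a) (suc b) p q r)) ,
  (λ i → eigenvector (suc i , zero) (eigenvalue-column (suc a) (suc b) p q r i)) ,
  (λ j → eigenvector (zero , suc j) (eigenvalue-row (suc a) (suc b) p q r j)) ,
  (λ z → eigenvector (interiorEdge z) (eigenvalue-interior (suc a) (suc b) p q r z)) ,
  flatten-Φ-isBasis
  where
  eigenvector : ∀ {ev} x → eigenvalue (ℕtoℚ p) (ℕtoℚ q) (ℕtoℚ r) x ≡ ev → IsEigenvector H ev (Φ x)
  eigenvector x refl =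
    IsEigenvector-Φ H (ℕtoℚ p) (ℕtoℚ q) (ℕtoℚ r) (H≡hessianModel hessian Cp Cq Cr) x
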